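{- In any two-stripe symmetric circulant TSP instance with parameters $n,a_1,a_2$ satisfying the standing assumptions below, there exists a Hamiltonian cycle of cost $2(g_1-1)$, where $g_1=\gcd(n,a_1)$.
   Context: Two-stripe symmetric circulant TSP: the vertex set is $\mathbb{Z}_n$, and for two distinct integers $a_1,a_2\in\{1,\dots,\lfloor n/2\rfloor\}$ the only finite-cost edges are $\{v,v\pm a_1\bmod n\}$ (cost $0$) and $\{v,v\pm a_2\bmod n\}$ (cost $1$); the cost of a Hamiltonian cycle is its number of edges of length $a_2$. Standing assumptions: $\gcd(n,a_1)>1$ and $\gcd(n,a_1,a_2)=1$. -}

module Defs where

open import Data.Nat using (ℕ; suc; _+_; NonZero)
open import Data.Nat.DivMod using (_%_; m%n<n)
open import Data.Fin using (Fin; toℕ; fromℕ<)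
open import Data.Fin.Permutation using (Permutation′; _⟨$⟩ʳ_)
open import Data.List using (length; filter; allFin)
open import Data.Sum using (_⊎_)
open import Data.Nat.Properties using (_≟_)
open import Relation.Nullary using (Dec)
open import Relation.Nullary.Decidable using (_⊎-dec_)
open import Relation.Binary.PropositionalEquality using (_≡_)

Step : (n : ℕ) → .{{NonZero n}} → ℕ → Fin n → Fin n → Set
Step n a u v = ((toℕ u + a) % n ≡ toℕ v) ⊎ ((toℕ v + a) % n ≡ toℕ u)

step? : (n : ℕ) → .{{_ : NonZero n}} → (a : ℕ) → (u v : Fin n) → Dec (Step n a u v)
step? n a u v = ((toℕ u + a) % n ≟ toℕ v) ⊎-dec ((toℕ v + a) % n ≟ toℕ u)

next : (n : ℕ) → .{{_ : NonZero n}} → Fin n → Fin n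
next n i = fromℕ< (m%n<n (suc (toℕ i)) n)

record HamCycle (n : ℕ) .{{_ : NonZero n}} (a₁ a₂ : ℕ) : Set where
  field
    tour  : Permutation′ n
    valid : ∀ i → Step n a₁ (tour ⟨$⟩ʳ i) (tour ⟨$⟩ʳ next n i)
                ⊎ Step n a₂ (tour ⟨$⟩ʳ i) (tour ⟨$⟩ʳ next n i)

cost : {n : ℕ} .{{_ : NonZero n}} {a₁ a₂ : ℕ} → HamCycle n a₁ a₂ → ℕ
cost {n} {a₁} {a₂} H =
  length (filter (λ i → step? n a₂ (tour ⟨$⟩ʳ i) (tour ⟨$⟩ʳ next n i)) (allFin n))
  where open HamCycle H

-- Let g = gcd n a₁ and m = n / g. The n residues (i a₁ + j a₂) mod n with i < m and j < g are
-- pairwise distinct (a₁ has order m in ℤ_n, and a₂ generates ℤ_n modulo ⟨a₁⟩ = gℤ_n since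
-- gcd g a₂ = 1), so they form a g × m grid covering ℤ_n in which a₁-steps move along a row
-- (cyclically, as m a₁ ≡ 0) and a₂-steps move up a column. The tour descends column 0 from
-- row g - 1 to row 0, wraps to column m - 1, snakes through rows 0, …, g - 1 on columns
-- 1, …, m - 1, and returns to column 0 of the top row by an a₁-step. Its a₂-edges are the
-- g - 1 steps down column 0 and the g - 1 changes of row; because a₁ ≠ a₂ and a₁ + a₂ < n,
-- no a₁-edge is also an a₂-edge, so the cost is exactly 2(g - 1).

module Submission where

open import Defs
open import Data.Bool using (Bool; true; false; not; if_then_else_)
open import Data.Nat
open import Data.Nat.Properties
open import Data.Nat.DivMod
open import Data.Nat.Divisibility
open import Data.Nat.GCD
open import Data.Nat.Coprimality using (coprime-/gcd; coprime-divisor)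
open import Data.Fin using (Fin; toℕ; fromℕ<; punchOut)
open import Data.Fin.Properties
  using (any?; punchOut-injective; injective⇒≤; toℕ-fromℕ<; toℕ-injective; toℕ<n) renaming (_≟_ to _≟ᶠ_)
open import Data.Fin.Permutation using (Permutation′)
open import Data.List using (List; []; _∷_; _++_; length; filter; map; tabulate; allFin)
open import Data.List.Properties using (filter-++; length-++; map-tabulate; tabulate-cong)
open import Data.Product using (Σ; _×_; _,_; proj₁; uncurry)
import Data.Sum as Sum
open import Data.Sum using (_⊎_; inj₁; inj₂; [_,_]′)
open import Function.Bundles using (mk⤖)
open import Function.Definitions using (Injective; Surjective)
open import Function.Properties.Bijection using (⤖⇒↔)
open import Relation.Nullary using (¬_; Dec; yes; no; contradiction)
open import Relation.Nullary.Decidable using (_⊎-dec_)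
open import Relation.Unary using (Pred; Decidable)
open import Relation.Binary.Definitions using (tri<; tri≈; tri>)
open import Relation.Binary.PropositionalEquality
  using (_≡_; _≢_; refl; sym; ≢-sym; trans; cong; cong₂; subst; subst₂; module ≡-Reasoning)

injective⇒surjective : ∀ {n} (f : Fin n → Fin n) → Injective _≡_ _≡_ f → Surjective _≡_ _≡_ f
injective⇒surjective {zero} f f-inj ()
injective⇒surjective {suc n} f f-inj y with any? (λ x → f x ≟ᶠ y)
... | yes (x , fx≡y) = x , λ { refl → fx≡y }
... | no ∄x = contradiction (injective⇒≤ punchOut∘f-injective) (n≮n n)
  where
  y≢f : ∀ x → y ≢ f x
  y≢f x y≡fx = ∄x (x , sym y≡fx)
  punchOut∘f-injective : Injective _≡_ _≡_ (λ x → punchOut (y≢f x))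
  punchOut∘f-injective eq = f-inj (punchOut-injective (y≢f _) (y≢f _) eq)

injective⇒permutation : ∀ {n} (f : Fin n → Fin n) → Injective _≡_ _≡_ f → Permutation′ n
injective⇒permutation f f-inj = ⤖⇒↔ (mk⤖ {to = f} (f-inj , injective⇒surjective f f-inj))

%≡%⇒∣∸ : ∀ d .{{_ : NonZero d}} x y → x % d ≡ y % d → d ∣ x ∸ y
%≡%⇒∣∸ d x y eq = divides (x / d ∸ y / d) (begin
  x ∸ y                                   ≡⟨ cong₂ _∸_ (m≡m%n+[m/n]*n x d) (m≡m%n+[m/n]*n y d) ⟩
  (x % d + x / d * d) ∸ (y % d + y / d * d) ≡⟨ cong (λ r → (r + x / d * d) ∸ (y % d + y / d * d)) eq ⟩
  (y % d + x / d * d) ∸ (y % d + y / d * d) ≡⟨ [m+n]∸[m+o]≡n∸o (y % d) _ _ ⟩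
  x / d * d ∸ y / d * d                   ≡⟨ *-distribʳ-∸ d (x / d) (y / d) ⟨
  (x / d ∸ y / d) * d                     ∎)
  where open ≡-Reasoning

∣∧<⇒≡0 : ∀ {d x} → d ∣ x → x < d → x ≡ 0
∣∧<⇒≡0 {x = zero}  _   _   = refl
∣∧<⇒≡0 {x = suc _} d∣x x<d = contradiction d∣x (>⇒∤ x<d)

∣∸⇒≡ : ∀ {d i i'} → i' ≤ i → i < d → d ∣ i ∸ i' → i ≡ i'
∣∸⇒≡ {i = i} {i'} i'≤i i<d d∣i∸i' =
  ≤-antisym (m∸n≡0⇒m≤n (∣∧<⇒≡0 d∣i∸i' (≤-<-trans (m∸n≤m i i') i<d))) i'≤i

[m%n+k]%n≡[m+k]%n : ∀ m k n .{{_ : NonZero n}} → (m % n + k) % n ≡ (m + k) % n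
[m%n+k]%n≡[m+k]%n m k n = begin
  (m % n + k) % n         ≡⟨ %-distribˡ-+ (m % n) k n ⟩
  (m % n % n + k % n) % n ≡⟨ cong (λ v → (v + k % n) % n) (m%n%n≡m%n m n) ⟩
  (m % n + k % n) % n     ≡⟨ %-distribˡ-+ m k n ⟨
  (m + k) % n             ∎
  where open ≡-Reasoning

+-%-cancelˡ : ∀ {n} .{{_ : NonZero n}} x {a b} → a < n → b < n → (x + a) % n ≡ (x + b) % n → a ≡ b
+-%-cancelˡ {n} x {a} {b} a<n b<n eq =
  [ (λ b≤a → ordered b≤a a<n eq) , (λ a≤b → sym (ordered a≤b b<n (sym eq))) ]′ (≤-total b a)
  where
  ordered : ∀ {a b} → b ≤ a → a < n → (x + a) % n ≡ (x + b) % n → a ≡ b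
  ordered {a} {b} b≤a a<n eq = ∣∸⇒≡ b≤a a<n (subst (n ∣_) ([m+n]∸[m+o]≡n∸o x a b) (%≡%⇒∣∸ n _ _ eq))

m<n⇒[m+kn]/n≡k : ∀ {m n} k .{{_ : NonZero n}} → m < n → (m + k * n) / n ≡ k
m<n⇒[m+kn]/n≡k {m} {n} k m<n = begin
  (m + k * n) / n   ≡⟨ +-distrib-/-∣ʳ m (n∣m*n k) ⟩
  m / n + k * n / n ≡⟨ cong₂ _+_ (m<n⇒m/n≡0 m<n) (m*n/n≡m k n) ⟩
  k                 ∎
  where open ≡-Reasoning

m<n⇒[m+kn]%n≡m : ∀ {m n} k .{{_ : NonZero n}} → m < n → (m + k * n) % n ≡ m
m<n⇒[m+kn]%n≡m {m} {n} k m<n = trans ([m+kn]%n≡m%n m k n) (m<n⇒m%n≡m m<n)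

n/2+n/2≤n : ∀ n → n / 2 + n / 2 ≤ n
n/2+n/2≤n n = subst (_≤ n) (trans (*-comm (n / 2) 2) (cong (n / 2 +_) (+-identityʳ (n / 2)))) (m/n*n≤m n 2)

≤n/2∧≢⇒+<n : ∀ {a b n} → a ≤ n / 2 → b ≤ n / 2 → a ≢ b → a + b < n
≤n/2∧≢⇒+<n {a} {b} {n} a≤n/2 b≤n/2 a≢b with <-cmp a b
... | tri< a<b _ _ = <-≤-trans (+-monoˡ-< b a<b) (≤-trans (+-mono-≤ b≤n/2 b≤n/2) (n/2+n/2≤n n))
... | tri≈ _ a≡b _ = contradiction a≡b a≢b
... | tri> _ _ b<a = <-≤-trans (+-monoʳ-< a b<a) (≤-trans (+-mono-≤ a≤n/2 a≤n/2) (n/2+n/2≤n n))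

gcd-nonZero : ∀ n a .{{_ : NonZero n}} → NonZero (gcd n a)
gcd-nonZero n a = ≢-nonZero (gcd[m,n]≢0 n a (inj₁ (≢-nonZero⁻¹ n)))

-- Dividing out g = gcd n a leaves the coprime pair n / g, a / g, so n ∣ (i - i') a forces n / g ∣ i - i'.
*-+-%-injective : ∀ n a c .{{_ : NonZero n}} .{{_ : NonZero (gcd n a)}} {i i'} →
                  i < n / gcd n a → i' < n / gcd n a → (i * a + c) % n ≡ (i' * a + c) % n → i ≡ i'
*-+-%-injective n a c {i} {i'} i<m i'<m eq =
  [ (λ i'≤i → ordered i'≤i i<m eq) , (λ i≤i' → sym (ordered i≤i' i'<m (sym eq))) ]′ (≤-total i' i)
  where
  g : ℕ
  g = gcd n a

  ordered : ∀ {i i'} → i' ≤ i → i < n / g → (i * a + c) % n ≡ (i' * a + c) % n → i ≡ i'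
  ordered {i} {i'} i'≤i i<m eq = ∣∸⇒≡ i'≤i i<m (coprime-divisor (coprime-/gcd n a) n/g∣a/g*d)
    where
    open ≡-Reasoning
    d : ℕ
    d = i ∸ i'
    difference : (i * a + c) ∸ (i' * a + c) ≡ a / g * d * g
    difference = begin
      (i * a + c) ∸ (i' * a + c) ≡⟨ cong₂ _∸_ (+-comm (i * a) c) (+-comm (i' * a) c) ⟩
      (c + i * a) ∸ (c + i' * a) ≡⟨ [m+n]∸[m+o]≡n∸o c (i * a) (i' * a) ⟩
      i * a ∸ i' * a             ≡⟨ *-distribʳ-∸ a i i' ⟨
      d * a                      ≡⟨ cong (d *_) (m/n*n≡m (gcd[m,n]∣n n a)) ⟨
      d * (a / g * g)            ≡⟨ *-assoc d (a / g) g ⟨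
      d * (a / g) * g            ≡⟨ cong (_* g) (*-comm d (a / g)) ⟩
      a / g * d * g              ∎
    n/g∣a/g*d : n / g ∣ a / g * d
    n/g∣a/g*d = *-cancelʳ-∣ g (subst₂ _∣_ (sym (m/n*n≡m (gcd[m,n]∣m n a))) difference (%≡%⇒∣∸ n _ _ eq))

grid-injective : ∀ n a₁ a₂ .{{_ : NonZero n}} .{{_ : NonZero (gcd n a₁)}} → gcd (gcd n a₁) a₂ ≡ 1 →
  ∀ {i i' j j'} → i < n / gcd n a₁ → i' < n / gcd n a₁ → j < gcd n a₁ → j' < gcd n a₁ →
  (i * a₁ + j * a₂) % n ≡ (i' * a₁ + j' * a₂) % n → i ≡ i' × j ≡ j'
grid-injective n a₁ a₂ g⊥a₂ {i} {i'} {j} {j'} i<m i'<m j<g j'<g eq with j≡j'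
  where
  g : ℕ
  g = gcd n a₁
  instance
    gcd[g,a₂]≢0 : NonZero (gcd g a₂)
    gcd[g,a₂]≢0 = gcd-nonZero g a₂
  %g : ∀ i j → (i * a₁ + j * a₂) % n % g ≡ (j * a₂ + 0) % g
  %g i j = begin
    (i * a₁ + j * a₂) % n % g ≡⟨ m∣n⇒o%n%m≡o%m g n _ (gcd[m,n]∣m n a₁) ⟩
    (i * a₁ + j * a₂) % g     ≡⟨ %-remove-+ˡ (j * a₂) (∣n⇒∣m*n i (gcd[m,n]∣n n a₁)) ⟩
    (j * a₂) % g              ≡⟨ cong (_% g) (+-identityʳ (j * a₂)) ⟨
    (j * a₂ + 0) % g          ∎
    where open ≡-Reasoning
  g/gcd≡g : g / gcd g a₂ ≡ g
  g/gcd≡g = trans (/-congʳ {m = g} g⊥a₂) (n/1≡n g)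
  j≡j' : j ≡ j'
  j≡j' = *-+-%-injective g a₂ 0 (subst (j <_) (sym g/gcd≡g) j<g) (subst (j' <_) (sym g/gcd≡g) j'<g)
           (trans (sym (%g i j)) (trans (cong (_% g) eq) (%g i' j')))
... | refl = *-+-%-injective n a₁ (j * a₂) i<m i'<m eq , refl

n∣[n/gcd[n,a]]*a : ∀ n a .{{_ : NonZero (gcd n a)}} → n ∣ n / gcd n a * a
n∣[n/gcd[n,a]]*a n a = subst (_∣ n / gcd n a * a) (m/n*n≡m (gcd[m,n]∣m n a))
  (*-monoʳ-∣ (n / gcd n a) (gcd[m,n]∣n n a))

2≤n/gcd[n,a] : ∀ n a .{{_ : NonZero (gcd n a)}} → 0 < a → a < n → 2 ≤ n / gcd n a
2≤n/gcd[n,a] n a 0<a a<n = ≮⇒≥ λ m<2 → n≮n n (begin-strict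
  n               ≡⟨ m/n*n≡m (gcd[m,n]∣m n a) ⟨
  n / gcd n a * gcd n a ≤⟨ *-monoˡ-≤ (gcd n a) (s≤s⁻¹ m<2) ⟩
  1 * gcd n a     ≡⟨ *-identityˡ (gcd n a) ⟩
  gcd n a         ≤⟨ ∣⇒≤ {{>-nonZero 0<a}} (gcd[m,n]∣n n a) ⟩
  a               <⟨ a<n ⟩
  n               ∎)
  where open ≤-Reasoning

Stepℕ : (n : ℕ) → .{{NonZero n}} → ℕ → ℕ → ℕ → Set
Stepℕ n a x y = ((x + a) % n ≡ y) ⊎ ((y + a) % n ≡ x)

Stepℕ? : (n : ℕ) → .{{_ : NonZero n}} → (a x y : ℕ) → Dec (Stepℕ n a x y)
Stepℕ? n a x y = ((x + a) % n ≟ y) ⊎-dec ((y + a) % n ≟ x)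

module _ {n : ℕ} .{{_ : NonZero n}} where

  Stepℕ-sym : ∀ {a x y} → Stepℕ n a x y → Stepℕ n a y x
  Stepℕ-sym (inj₁ x+a≡y) = inj₂ x+a≡y
  Stepℕ-sym (inj₂ y+a≡x) = inj₁ y+a≡x

  Stepℕ-+ : ∀ {a x y} → x + a ≡ y → Stepℕ n a (x % n) (y % n)
  Stepℕ-+ {a} {x} x+a≡y = inj₁ (trans ([m%n+k]%n≡[m+k]%n x a n) (cong (_% n) x+a≡y))

  round-trip≡0 : ∀ {a b x y} → a + b < n → (x + a) % n ≡ y → (y + b) % n ≡ x → a + b ≡ 0
  round-trip≡0 {a} {b} {x} {y} a+b<n x+a≡y y+b≡x = +-%-cancelˡ x a+b<n (≤-<-trans z≤n a+b<n) (begin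
    (x + (a + b)) % n   ≡⟨ cong (_% n) (+-assoc x a b) ⟨
    (x + a + b) % n     ≡⟨ [m%n+k]%n≡[m+k]%n (x + a) b n ⟨
    ((x + a) % n + b) % n ≡⟨ cong (λ v → (v + b) % n) x+a≡y ⟩
    (y + b) % n         ≡⟨ y+b≡x ⟩
    x                   ≡⟨ m<n⇒m%n≡m (subst (_< n) y+b≡x (m%n<n (y + b) n)) ⟨
    x % n               ≡⟨ cong (_% n) (+-identityʳ x) ⟨
    (x + 0) % n         ∎)
    where open ≡-Reasoning

  Stepℕ-exclusive : ∀ {a b x y} → a ≢ b → a + b < n → Stepℕ n a x y → ¬ Stepℕ n b x y
  Stepℕ-exclusive {a} {b} {x} {y} a≢b a+b<n = exclusive
    where
    a<n : a < n
    a<n = ≤-<-trans (m≤m+n a b) a+b<n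
    b<n : b < n
    b<n = ≤-<-trans (m≤n+m b a) a+b<n
    a+b≢0 : a + b ≢ 0
    a+b≢0 a+b≡0 = a≢b (trans (m+n≡0⇒m≡0 a a+b≡0) (sym (m+n≡0⇒n≡0 a a+b≡0)))
    exclusive : Stepℕ n a x y → ¬ Stepℕ n b x y
    exclusive (inj₁ p) (inj₁ q) = a≢b (+-%-cancelˡ x a<n b<n (trans p (sym q)))
    exclusive (inj₁ p) (inj₂ q) = a+b≢0 (round-trip≡0 a+b<n p q)
    exclusive (inj₂ p) (inj₁ q) =
      a+b≢0 (trans (+-comm a b) (round-trip≡0 (subst (_< n) (+-comm a b) a+b<n) q p))
    exclusive (inj₂ p) (inj₂ q) = a≢b (+-%-cancelˡ y a<n b<n (trans p (sym q)))

length-filter-map : ∀ {a b p q} {A : Set a} {B : Set b} {P : Pred A p} {Q : Pred B q}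
  (P? : Decidable P) (Q? : Decidable Q) (f : A → B) →
  (∀ x → P x → Q (f x)) → (∀ x → Q (f x) → P x) →
  ∀ xs → length (filter P? xs) ≡ length (filter Q? (map f xs))
length-filter-map P? Q? f P⇒Q Q⇒P [] = refl
length-filter-map P? Q? f P⇒Q Q⇒P (x ∷ xs) with P? x | Q? (f x)
... | yes _  | yes _  = cong suc (length-filter-map P? Q? f P⇒Q Q⇒P xs)
... | yes p  | no ¬q  = contradiction (P⇒Q x p) ¬q
... | no ¬p  | yes q  = contradiction (Q⇒P x q) ¬p
... | no _   | no _   = length-filter-map P? Q? f P⇒Q Q⇒P xs

interval : ℕ → ℕ → List ℕ
interval a zero    = []
interval a (suc l) = a ∷ interval (suc a) l

interval-++ : ∀ a l₁ l₂ → interval a (l₁ + l₂) ≡ interval a l₁ ++ interval (a + l₁) l₂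
interval-++ a zero     l₂ = cong (λ b → interval b l₂) (sym (+-identityʳ a))
interval-++ a (suc l₁) l₂ =
  cong (a ∷_) (trans (interval-++ (suc a) l₁ l₂)
                     (cong (λ b → interval (suc a) l₁ ++ interval b l₂) (sym (+-suc a l₁))))

tabulate-+≡interval : ∀ a l → tabulate {n = l} (λ i → a + toℕ i) ≡ interval a l
tabulate-+≡interval a zero    = refl
tabulate-+≡interval a (suc l) = cong₂ _∷_ (+-identityʳ a)
  (trans (tabulate-cong (λ i → +-suc a (toℕ i))) (tabulate-+≡interval (suc a) l))

map-toℕ-allFin : ∀ n → map toℕ (allFin n) ≡ interval 0 n
map-toℕ-allFin n = trans (map-tabulate (λ i → i) toℕ) (tabulate-+≡interval 0 n)

module _ {q} {Q : Pred ℕ q} (Q? : Decidable Q) where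

  count : ℕ → ℕ → ℕ
  count a l = length (filter Q? (interval a l))

  count-+ : ∀ a l₁ l₂ → count a (l₁ + l₂) ≡ count a l₁ + count (a + l₁) l₂
  count-+ a l₁ l₂ rewrite interval-++ a l₁ l₂ | filter-++ Q? (interval a l₁) (interval (a + l₁) l₂) =
    length-++ (filter Q? (interval a l₁))

  count-none : ∀ a l → (∀ i → i < l → ¬ Q (a + i)) → count a l ≡ 0
  count-none a zero    none = refl
  count-none a (suc l) none with Q? a
  ... | yes q = contradiction (subst Q (sym (+-identityʳ a)) q) (none 0 z<s)
  ... | no  _ = count-none (suc a) l (λ i i<l q → none (suc i) (s≤s i<l) (subst Q (sym (+-suc a i)) q))

  count-all : ∀ a l → (∀ i → i < l → Q (a + i)) → count a l ≡ l
  count-all a zero    all = refl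
  count-all a (suc l) all with Q? a
  ... | yes _ = cong suc (count-all (suc a) l (λ i i<l → subst Q (+-suc a i) (all (suc i) (s≤s i<l))))
  ... | no ¬q = contradiction (subst Q (+-identityʳ a) (all 0 z<s)) ¬q

  count-yes : ∀ a → Q a → count a 1 ≡ 1
  count-yes a q with Q? a
  ... | yes _ = refl
  ... | no ¬q = contradiction q ¬q

  count-no : ∀ a → ¬ Q a → count a 1 ≡ 0
  count-no a ¬q with Q? a
  ... | yes q = contradiction q ¬q
  ... | no  _ = refl

module Snake {n : ℕ} .{{_ : NonZero n}} {a₁ a₂ : ℕ} (G K : ℕ)
  (n≡g*m : n ≡ suc G * suc (suc K))
  (grid-inj : ∀ {i i' j j'} → i < suc (suc K) → i' < suc (suc K) → j < suc G → j' < suc G →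
              (i * a₁ + j * a₂) % n ≡ (i' * a₁ + j' * a₂) % n → i ≡ i' × j ≡ j')
  (n∣m*a₁ : n ∣ suc (suc K) * a₁)
  (exclusive : ∀ {x y} → Stepℕ n a₁ x y → ¬ Stepℕ n a₂ x y)
  where

  -- g rows, m = suc M columns; the rows are snaked through on columns 1, …, M.
  g M : ℕ
  g = suc G
  M = suc K

  n≡g+g*M : n ≡ g + g * M
  n≡g+g*M = trans n≡g*m (*-suc g M)

  vertex : ℕ → ℕ → ℕ
  vertex i j = (i * a₁ + j * a₂) % n

  vertex-up : ∀ i j → Stepℕ n a₂ (vertex i j) (vertex i (suc j))
  vertex-up i j = Stepℕ-+ (trans (+-assoc (i * a₁) (j * a₂) a₂) (cong (i * a₁ +_) (+-comm (j * a₂) a₂)))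

  vertex-right : ∀ i j → Stepℕ n a₁ (vertex i j) (vertex (suc i) j)
  vertex-right i j = Stepℕ-+ (trans (+-comm (i * a₁ + j * a₂) a₁) (sym (+-assoc a₁ (i * a₁) (j * a₂))))

  vertex-wrap : ∀ j → Stepℕ n a₁ (vertex M j) (vertex 0 j)
  vertex-wrap j = subst (Stepℕ n a₁ (vertex M j))
    (trans (cong (_% n) (+-comm (suc M * a₁) (j * a₂))) (%-remove-+ʳ (j * a₂) n∣m*a₁))
    (vertex-right M j)

  even : ℕ → Bool
  even zero    = true
  even (suc r) = not (even r)

  column : ℕ → ℕ → ℕ
  column r t = if even r then M ∸ t else suc t

  column-positive : ∀ r {t} → t < M → 0 < column r t
  column-positive r {t} t<M with even r
  ... | true  = m<n⇒0<n∸m t<M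
  ... | false = z<s

  column-≤ : ∀ r {t} → t < M → column r t ≤ M
  column-≤ r {t} t<M with even r
  ... | true  = m∸n≤m M t
  ... | false = t<M

  column-injective : ∀ r {t t'} → t < M → t' < M → column r t ≡ column r t' → t ≡ t'
  column-injective r t<M t'<M eq with even r
  ... | true  = ∸-cancelˡ-≡ (<⇒≤ t<M) (<⇒≤ t'<M) eq
  ... | false = suc-injective eq

  column-step : ∀ r {t} → suc t < M → Stepℕ n a₁ (vertex (column r t) r) (vertex (column r (suc t)) r)
  column-step r {t} 1+t<M with even r
  ... | true  = subst (λ c → Stepℕ n a₁ (vertex c r) (vertex (M ∸ suc t) r)) (sym (+-∸-assoc 1 (<⇒≤ 1+t<M)))
                  (Stepℕ-sym (vertex-right (M ∸ suc t) r))
  ... | false = vertex-right (suc t) r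

  column-turn : ∀ r → column r K ≡ column (suc r) 0
  column-turn r with even r
  ... | true  = m+n∸n≡m 1 K
  ... | false = refl

  column-close : ∀ r → Stepℕ n a₁ (vertex (column r K) r) (vertex 0 r)
  column-close r with even r
  ... | true  = subst (λ c → Stepℕ n a₁ (vertex c r) (vertex 0 r)) (sym (m+n∸n≡m 1 K))
                  (Stepℕ-sym (vertex-right 0 r))
  ... | false = vertex-wrap r

  cell : ℕ → ℕ × ℕ
  cell k with k <? g
  ... | yes _ = 0 , G ∸ k
  ... | no  _ = column ((k ∸ g) / M) ((k ∸ g) % M) , (k ∸ g) / M

  tourℕ : ℕ → ℕ
  tourℕ k = uncurry vertex (cell k)

  tourℕ-descent : ∀ {k} → k < g → tourℕ k ≡ vertex 0 (G ∸ k)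
  tourℕ-descent {k} k<g with k <? g
  ... | yes _   = refl
  ... | no  k≮g = contradiction k<g k≮g

  tourℕ-row : ∀ r {t} → t < M → tourℕ (g + (t + r * M)) ≡ vertex (column r t) r
  tourℕ-row r {t} t<M with g + (t + r * M) <? g
  ... | yes lt = contradiction lt (m+n≮m g (t + r * M))
  ... | no  _ rewrite m+n∸m≡n g (t + r * M) | m<n⇒[m+kn]/n≡k r t<M | m<n⇒[m+kn]%n≡m r t<M = refl

  data Position : ℕ → Set where
    descent : ∀ {k} → k < g → Position k
    row     : ∀ r {t} → r < g → t < M → Position (g + (t + r * M))

  position : ∀ {k} → k < n → Position k
  position {k} k<n with k <? g
  ... | yes k<g = descent k<g
  ... | no  k≮g = subst Position k≡ (row ((k ∸ g) / M) r<g (m%n<n (k ∸ g) M))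
    where
    g≤k : g ≤ k
    g≤k = ≮⇒≥ k≮g
    k≡ : g + ((k ∸ g) % M + (k ∸ g) / M * M) ≡ k
    k≡ = trans (cong (g +_) (sym (m≡m%n+[m/n]*n (k ∸ g) M))) (m+[n∸m]≡n g≤k)
    r<g : (k ∸ g) / M < g
    r<g = m<n*o⇒m/o<n (+-cancelˡ-< g (k ∸ g) (g * M) (subst₂ _<_ (sym (m+[n∸m]≡n g≤k)) n≡g+g*M k<n))

  row-position< : ∀ {r t} → r < g → t < M → g + (t + r * M) < n
  row-position< {r} {t} r<g t<M = subst (g + (t + r * M) <_) (sym n≡g+g*M)
    (+-monoʳ-< g (<-≤-trans (+-monoˡ-< (r * M) t<M) (*-monoˡ-≤ M r<g)))

  tourℕ-injective : ∀ {k k'} → k < n → k' < n → tourℕ k ≡ tourℕ k' → k ≡ k'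
  tourℕ-injective k<n k'<n = injective (position k<n) (position k'<n)
    where
    G∸k<g : ∀ k → G ∸ k < g
    G∸k<g k = s≤s (m∸n≤m G k)
    column<m : ∀ r {t} → t < M → column r t < suc M
    column<m r t<M = s≤s (column-≤ r t<M)
    injective : ∀ {k k'} → Position k → Position k' → tourℕ k ≡ tourℕ k' → k ≡ k'
    injective (descent {k} k<g) (descent {k'} k'<g) eq
      with _ , G∸k≡G∸k' ← grid-inj z<s z<s (G∸k<g k) (G∸k<g k')
             (trans (sym (tourℕ-descent k<g)) (trans eq (tourℕ-descent k'<g)))
      = ∸-cancelˡ-≡ (s≤s⁻¹ k<g) (s≤s⁻¹ k'<g) G∸k≡G∸k'
    injective (descent {k} k<g) (row r' r'<g t'<M) eq = contradiction
      (proj₁ (grid-inj z<s (column<m r' t'<M) (G∸k<g k) r'<g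
        (trans (sym (tourℕ-descent k<g)) (trans eq (tourℕ-row r' t'<M)))))
      (<⇒≢ (column-positive r' t'<M))
    injective (row r r<g t<M) (descent {k'} k'<g) eq = contradiction
      (proj₁ (grid-inj (column<m r t<M) z<s r<g (G∸k<g k')
        (trans (sym (tourℕ-row r t<M)) (trans eq (tourℕ-descent k'<g)))))
      (≢-sym (<⇒≢ (column-positive r t<M)))
    injective (row r r<g t<M) (row r' r'<g t'<M) eq
      with c≡c' , refl ← grid-inj (column<m r t<M) (column<m r' t'<M) r<g r'<g
             (trans (sym (tourℕ-row r t<M)) (trans eq (tourℕ-row r' t'<M)))
      = cong (λ t → g + (t + r * M)) (column-injective r t<M t'<M c≡c')

  nextℕ : ℕ → ℕ
  nextℕ k = suc k % n

  TourStep : ℕ → ℕ → Set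
  TourStep a k = Stepℕ n a (tourℕ k) (tourℕ (nextℕ k))

  nextℕ-< : ∀ {k} → suc k < n → nextℕ k ≡ suc k
  nextℕ-< = m<n⇒m%n≡m

  TourStep-from : ∀ {a k x y} → tourℕ k ≡ x → tourℕ (nextℕ k) ≡ y → Stepℕ n a x y → TourStep a k
  TourStep-from refl refl step = step

  nextℕ-row : ∀ {r t} → g + (suc t + r * M) < n → nextℕ (g + (t + r * M)) ≡ g + (suc t + r * M)
  nextℕ-row {r} {t} lt = trans (nextℕ-< (subst (_< n) (+-suc g (t + r * M)) lt)) (sym (+-suc g (t + r * M)))

  g<n : g < n
  g<n = subst (_< n) (+-identityʳ g) (row-position< {0} {0} z<s z<s)

  descent-step : ∀ {k} → suc k < g → TourStep a₂ k
  descent-step {k} 1+k<g = TourStep-from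
    (trans (tourℕ-descent (<-trans (n<1+n k) 1+k<g)) (cong (vertex 0) (+-∸-assoc 1 (s≤s⁻¹ 1+k<g))))
    (trans (cong tourℕ (nextℕ-< (<-trans 1+k<g g<n))) (tourℕ-descent 1+k<g))
    (Stepℕ-sym (vertex-up 0 (G ∸ suc k)))

  corner-step : TourStep a₁ G
  corner-step = TourStep-from
    (trans (tourℕ-descent (n<1+n G)) (cong (vertex 0) (n∸n≡0 G)))
    (trans (cong tourℕ (trans (nextℕ-< g<n) (sym (+-identityʳ g)))) (tourℕ-row 0 z<s))
    (Stepℕ-sym (vertex-wrap 0))

  row-step : ∀ {r t} → r < g → suc t < M → TourStep a₁ (g + (t + r * M))
  row-step {r} {t} r<g 1+t<M = TourStep-from
    (tourℕ-row r (<-trans (n<1+n t) 1+t<M))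
    (trans (cong tourℕ (nextℕ-row {r} {t} (row-position< r<g 1+t<M))) (tourℕ-row r 1+t<M))
    (column-step r 1+t<M)

  row-change-step : ∀ {r} → suc r < g → TourStep a₂ (g + (K + r * M))
  row-change-step {r} 1+r<g = TourStep-from
    (trans (tourℕ-row r (n<1+n K)) (cong (λ c → vertex c r) (column-turn r)))
    (trans (cong tourℕ (nextℕ-row {r} {K} (row-position< 1+r<g z<s))) (tourℕ-row (suc r) z<s))
    (vertex-up (column (suc r) 0) r)

  last-position : suc (g + (K + G * M)) ≡ n
  last-position = trans (sym (+-suc g (K + G * M))) (sym n≡g+g*M)

  closing-step : TourStep a₁ (g + (K + G * M))
  closing-step = TourStep-from
    (tourℕ-row G (n<1+n K))
    (trans (cong tourℕ (trans (cong (_% n) last-position) (n%n≡0 n))) (tourℕ-descent z<s))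
    (column-close G)

  tour-step : ∀ {k} → k < n → TourStep a₁ k ⊎ TourStep a₂ k
  tour-step k<n with position k<n
  ... | descent k<g with m<1+n⇒m<n∨m≡n k<g
  ...   | inj₁ k<G  = inj₂ (descent-step (s≤s k<G))
  ...   | inj₂ refl = inj₁ corner-step
  tour-step k<n | row r r<g t<M with m<1+n⇒m<n∨m≡n t<M
  ...   | inj₁ t<K  = inj₁ (row-step r<g (s≤s t<K))
  ...   | inj₂ refl with m<1+n⇒m<n∨m≡n r<g
  ...     | inj₁ r<G  = inj₂ (row-change-step (s≤s r<G))
  ...     | inj₂ refl = inj₁ closing-step

  TourStep? : ∀ a k → Dec (TourStep a k)
  TourStep? a k = Stepℕ? n a (tourℕ k) (tourℕ (nextℕ k))

  #a₂ : ℕ → ℕ → ℕ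
  #a₂ = count (TourStep? a₂)

  #a₂-descent : #a₂ 0 g ≡ G
  #a₂-descent = begin
    #a₂ 0 g           ≡⟨ cong (#a₂ 0) (+-comm 1 G) ⟩
    #a₂ 0 (G + 1)     ≡⟨ count-+ (TourStep? a₂) 0 G 1 ⟩
    #a₂ 0 G + #a₂ G 1 ≡⟨ cong₂ _+_ (count-all (TourStep? a₂) 0 G (λ k k<G → descent-step (s≤s k<G)))
                                    (count-no (TourStep? a₂) G (exclusive corner-step)) ⟩
    G + 0             ≡⟨ +-identityʳ G ⟩
    G                 ∎
    where open ≡-Reasoning

  #a₂-row : ∀ {r} → r < g → #a₂ (g + r * M) M ≡ #a₂ (g + (K + r * M)) 1
  #a₂-row {r} r<g = begin
    #a₂ (g + r * M) M                         ≡⟨ cong (#a₂ (g + r * M)) (+-comm 1 K) ⟩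
    #a₂ (g + r * M) (K + 1)                   ≡⟨ count-+ (TourStep? a₂) (g + r * M) K 1 ⟩
    #a₂ (g + r * M) K + #a₂ (g + r * M + K) 1 ≡⟨ cong₂ _+_ inner (cong (λ k → #a₂ k 1) (shift K)) ⟩
    #a₂ (g + (K + r * M)) 1                   ∎
    where
    open ≡-Reasoning
    shift : ∀ t → g + r * M + t ≡ g + (t + r * M)
    shift t = trans (+-assoc g (r * M) t) (cong (g +_) (+-comm (r * M) t))
    inner : #a₂ (g + r * M) K ≡ 0
    inner = count-none (TourStep? a₂) (g + r * M) K
      (λ t t<K → subst (λ k → ¬ TourStep a₂ k) (sym (shift t)) (exclusive (row-step r<g (s≤s t<K))))

  #a₂-rows : ∀ R → R ≤ G → #a₂ g (R * M) ≡ R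
  #a₂-rows zero    _     = refl
  #a₂-rows (suc R) 1+R≤G = begin
    #a₂ g (M + R * M)                  ≡⟨ cong (#a₂ g) (+-comm M (R * M)) ⟩
    #a₂ g (R * M + M)                  ≡⟨ count-+ (TourStep? a₂) g (R * M) M ⟩
    #a₂ g (R * M) + #a₂ (g + R * M) M  ≡⟨ cong₂ _+_ (#a₂-rows R (<⇒≤ 1+R≤G)) (#a₂-row (m<n⇒m<1+n 1+R≤G)) ⟩
    R + #a₂ (g + (K + R * M)) 1        ≡⟨ cong (R +_) (count-yes (TourStep? a₂) _ row-change) ⟩
    R + 1                              ≡⟨ +-comm R 1 ⟩
    suc R                              ∎
    where
    open ≡-Reasoning
    row-change : TourStep a₂ (g + (K + R * M))
    row-change = row-change-step (s≤s 1+R≤G)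

  #a₂-tour : #a₂ 0 n ≡ G + G
  #a₂-tour = begin
    #a₂ 0 n                                       ≡⟨ cong (#a₂ 0) n≡g+[G*M+M] ⟩
    #a₂ 0 (g + (G * M + M))                       ≡⟨ count-+ (TourStep? a₂) 0 g (G * M + M) ⟩
    #a₂ 0 g + #a₂ g (G * M + M)                   ≡⟨ cong (#a₂ 0 g +_) (count-+ (TourStep? a₂) g (G * M) M) ⟩
    #a₂ 0 g + (#a₂ g (G * M) + #a₂ (g + G * M) M) ≡⟨ cong₂ _+_ #a₂-descent (cong₂ _+_ (#a₂-rows G ≤-refl) last-row) ⟩
    G + (G + 0)                                   ≡⟨ cong (G +_) (+-identityʳ G) ⟩
    G + G                                         ∎
    where
    open ≡-Reasoning
    n≡g+[G*M+M] : n ≡ g + (G * M + M)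
    n≡g+[G*M+M] = trans n≡g+g*M (cong (g +_) (+-comm M (G * M)))
    last-row : #a₂ (g + G * M) M ≡ 0
    last-row = trans (#a₂-row (n<1+n G)) (count-no (TourStep? a₂) _ (exclusive closing-step))

  tourℕ<n : ∀ k → tourℕ k < n
  tourℕ<n k = m%n<n _ n

  tourFin : Fin n → Fin n
  tourFin p = fromℕ< (tourℕ<n (toℕ p))

  toℕ-tourFin : ∀ p → toℕ (tourFin p) ≡ tourℕ (toℕ p)
  toℕ-tourFin p = toℕ-fromℕ< _

  toℕ-tourFin-next : ∀ p → toℕ (tourFin (next n p)) ≡ tourℕ (nextℕ (toℕ p))
  toℕ-tourFin-next p = trans (toℕ-tourFin (next n p)) (cong tourℕ (toℕ-fromℕ< (m%n<n (suc (toℕ p)) n)))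

  tourFin-injective : Injective _≡_ _≡_ tourFin
  tourFin-injective {p} {q} eq = toℕ-injective
    (tourℕ-injective (toℕ<n p) (toℕ<n q) (trans (sym (toℕ-tourFin p)) (trans (cong toℕ eq) (toℕ-tourFin q))))

  Step⇒TourStep : ∀ {a} p → Step n a (tourFin p) (tourFin (next n p)) → TourStep a (toℕ p)
  Step⇒TourStep p = subst₂ (Stepℕ n _) (toℕ-tourFin p) (toℕ-tourFin-next p)

  TourStep⇒Step : ∀ {a} p → TourStep a (toℕ p) → Step n a (tourFin p) (tourFin (next n p))
  TourStep⇒Step p = subst₂ (Stepℕ n _) (sym (toℕ-tourFin p)) (sym (toℕ-tourFin-next p))

  hamiltonian : HamCycle n a₁ a₂
  hamiltonian = record
    { tour  = injective⇒permutation tourFin tourFin-injective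
    ; valid = λ p → Sum.map (TourStep⇒Step p) (TourStep⇒Step p) (tour-step (toℕ<n p))
    }

  hamiltonian-cost : cost hamiltonian ≡ 2 * G
  hamiltonian-cost = begin
    cost hamiltonian                   ≡⟨ length-filter-map _ _ toℕ Step⇒TourStep TourStep⇒Step (allFin n) ⟩
    #a₂-in (map toℕ (allFin n))        ≡⟨ cong #a₂-in (map-toℕ-allFin n) ⟩
    #a₂ 0 n                            ≡⟨ #a₂-tour ⟩
    G + G                              ≡⟨ cong (G +_) (+-identityʳ G) ⟨
    2 * G                              ∎
    where
    open ≡-Reasoning
    #a₂-in : List ℕ → ℕ
    #a₂-in ks = length (filter (TourStep? a₂) ks)

snake-tour : ∀ {n} .{{_ : NonZero n}} {a₁ a₂} g m → 1 ≤ g → 2 ≤ m → n ≡ g * m →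
  (∀ {i i' j j'} → i < m → i' < m → j < g → j' < g →
     (i * a₁ + j * a₂) % n ≡ (i' * a₁ + j' * a₂) % n → i ≡ i' × j ≡ j') →
  n ∣ m * a₁ → (∀ {x y} → Stepℕ n a₁ x y → ¬ Stepℕ n a₂ x y) →
  Σ (HamCycle n a₁ a₂) (λ H → cost H ≡ 2 * (g ∸ 1))
snake-tour (suc G) (suc (suc K)) (s≤s z≤n) (s≤s (s≤s z≤n)) n≡g*m grid-inj n∣m*a₁ exclusive =
  hamiltonian , hamiltonian-cost
  where open Snake G K n≡g*m grid-inj n∣m*a₁ exclusive

proposition4 : (n a₁ a₂ : ℕ) → .{{_ : NonZero n}} →
    1 ≤ a₁ → a₁ ≤ n / 2 → 1 ≤ a₂ → a₂ ≤ n / 2 → a₁ ≢ a₂ →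
    1 < gcd n a₁ → gcd (gcd n a₁) a₂ ≡ 1 →
    Σ (HamCycle n a₁ a₂) (λ H → cost H ≡ 2 * (gcd n a₁ ∸ 1))
proposition4 n a₁ a₂ 0<a₁ a₁≤n/2 _ a₂≤n/2 a₁≢a₂ 1<g g⊥a₂ =
  snake-tour (gcd n a₁) (n / gcd n a₁) (<⇒≤ 1<g) (2≤n/gcd[n,a] n a₁ 0<a₁ a₁<n)
    (sym (m*[n/m]≡n (gcd[m,n]∣m n a₁))) (grid-injective n a₁ a₂ g⊥a₂) (n∣[n/gcd[n,a]]*a n a₁)
    (Stepℕ-exclusive a₁≢a₂ (≤n/2∧≢⇒+<n a₁≤n/2 a₂≤n/2 a₁≢a₂))
  where
  instance
    g≢0 : NonZero (gcd n a₁)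
    g≢0 = gcd-nonZero n a₁
  a₁<n : a₁ < n
  a₁<n = ≤-<-trans a₁≤n/2 (m/n<m n 2 (s≤s (s≤s z≤n)))
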